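{- If $G$ is a bi-$(\epsilon,\rho)$-dense graph on $n$ vertices with $\epsilon \geq 1/n$ and $B \subseteq V(G)$ with $|B| \geq 2\epsilon n$, then there are fewer than $3\epsilon n$ vertices in $G$ with fewer than $\frac{\rho}{2}|B|$ neighbors in $B$.
   Context: For disjoint vertex subsets $X,Y$ of a graph, $d(X,Y)=e(X,Y)/(|X||Y|)$, where $e(X,Y)$ is the number of edges with one endpoint in $X$ and the other in $Y$. A graph $G$ is bi-$(\epsilon,\rho)$-dense if for all disjoint $A,B\subseteq V(G)$ with $|A|,|B|\geq \epsilon|V(G)|$ we have $d(A,B)\geq\rho$.
   Formalization: The parameters $\epsilon$ and $\rho$ of bi-density, both in the hypothesis on $G$ and in the degree threshold, are rational numbers. -}

module Defs where

open import Data.Nat as ℕ using (ℕ; zero; suc)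
open import Data.Bool using (Bool; true; false; _∧_; if_then_else_; T)
open import Data.Fin using (Fin)
open import Data.Fin.Subset using (Subset; _∈_; ∣_∣)
open import Data.Nat.ListAction using (sum)
open import Data.List using (List; map; allFin; length; filter)
open import Data.Vec using (lookup)
open import Data.Integer using (+_)
open import Data.Rational using (ℚ; _/_; _≤_; _<_; _*_; 0ℚ; ½)
open import Data.Rational.Properties using (_<?_)
open import Relation.Binary.PropositionalEquality using (_≡_)
open import Data.Empty using (⊥)
open import Relation.Nullary using (does)

record Graph (n : ℕ) : Set where
  field
    adj     : Fin n → Fin n → Bool
    sym     : ∀ x y → adj x y ≡ adj y x
    irrefl  : ∀ x → adj x x ≡ false

open Graph public

countB : {n : ℕ} → (Fin n → Bool) → ℕ
countB {n} P = sum (map (λ x → if P x then 1 else 0) (allFin n))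

toℚ : ℕ → ℚ
toℚ k = + k / 1

Disjoint : {n : ℕ} → Subset n → Subset n → Set
Disjoint X Y = ∀ x → x ∈ X → x ∈ Y → ⊥

-- e(X,Y): number of ordered pairs (x,y), x ∈ X, y ∈ Y, with xy an edge
-- (for disjoint X, Y this is the number of edges between X and Y)
eB : {n : ℕ} → Graph n → Subset n → Subset n → ℕ
eB G X Y = sum (map (λ x → countB (λ y → lookup X x ∧ lookup Y y ∧ adj G x y)) (allFin _))

-- d(X,Y) = e(X,Y) / (|X| |Y|)  (set to 0 when a side is empty)
density : {n : ℕ} → Graph n → Subset n → Subset n → ℚ
density G X Y with ∣ X ∣ ℕ.* ∣ Y ∣
... | zero  = 0ℚ
... | suc k = + eB G X Y / suc k

BiDense : {n : ℕ} → Graph n → ℚ → ℚ → Set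
BiDense {n} G ε ρ =
  ∀ (A B : Subset n) → Disjoint A B →
    ε * toℚ n ≤ toℚ ∣ A ∣ → ε * toℚ n ≤ toℚ ∣ B ∣ → ρ ≤ density G A B

degIn : {n : ℕ} → Graph n → Fin n → Subset n → ℕ
degIn G v B = countB (λ u → lookup B u ∧ adj G v u)

lowDegCount : {n : ℕ} → Graph n → ℚ → Subset n → ℕ
lowDegCount G ρ B =
  countB (λ v → does (toℚ (degIn G v B) <? ½ * ρ * toℚ ∣ B ∣))

-- Put m = εn ≥ 1, let S be the set of vertices with fewer than (ρ/2)|B| neighbours in B,
-- suppose |S| ≥ 3m and let k = ⌈m⌉. Let X consist of all of S ∖ B, topped up to k vertices
-- from S ∩ B, and let Y be B minus the top-up. Counting gives |X|, |Y| ≥ k ≥ m and |Y| ≥ |B|/2,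
-- and X, Y are disjoint, so bi-density gives e(X,Y) ≥ ρ|X||Y|. But every vertex of X has
-- fewer than (ρ/2)|B| ≤ ρ|Y| neighbours in Y, so e(X,Y) < ρ|X||Y|.
module Submission where

open import Defs hiding (sym)
open import Data.Bool using (Bool; true; false; _∧_; if_then_else_)
open import Data.Empty using (⊥; ⊥-elim)
open import Data.Fin using (Fin; zero; suc)
open import Data.Fin.Subset renaming (⊥ to ∅)
open import Data.Fin.Subset.Properties
  using (⊥⊆; s⊆s; ∣⊥∣≡0; p─q⊆p; p∩q⊆p; p∩q⊆q; x∈p∪q⁻; ∣p∩q∣≤∣q∣)
open import Data.List using (map; allFin)
import Data.List.Properties as List
open import Data.Nat.ListAction using (sum)
open import Data.Product using (∃; _×_; _,_)
open import Data.Sum using (inj₁; inj₂)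
open import Data.Vec using ([]; _∷_; here; there; lookup; tabulate)
open import Data.Vec.Properties using (tabulate∘lookup; lookup∘tabulate; []=⇒lookup; lookup⇒[]=)
open import Function using (_∘_)
open import Relation.Binary.PropositionalEquality
open import Relation.Nullary using (Dec; does; yes; no)

-- The arithmetic of ℕ is opened only inside this module; outside it, _≤_, _<_, _+_ and _*_
-- are those of ℚ.
module Combinatorics where

  open import Data.Nat using (ℕ; zero; suc; z≤n; s≤s; _+_; _*_; _∸_; _≤_; _<_; _≤?_)
  open import Data.Nat.Properties

  ∑ : ∀ {n} → (Fin n → ℕ) → ℕ
  ∑ {zero}  f = 0
  ∑ {suc n} f = f zero + ∑ (f ∘ suc)

  indicator : Bool → ℕ
  indicator b = if b then 1 else 0

  sum-map-allFin : ∀ {n} (f : Fin n → ℕ) → sum (map f (allFin n)) ≡ ∑ f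
  sum-map-allFin f = trans (cong sum (List.map-tabulate (λ x → x) f)) (sum-tabulate f)
    where
    sum-tabulate : ∀ {n} (f : Fin n → ℕ) → sum (Data.List.tabulate f) ≡ ∑ f
    sum-tabulate {zero}  f = refl
    sum-tabulate {suc n} f = cong (f zero +_) (sum-tabulate (f ∘ suc))

  ∑-mono-≤ : ∀ {n} {f g : Fin n → ℕ} → (∀ x → f x ≤ g x) → ∑ f ≤ ∑ g
  ∑-mono-≤ {zero}  f≤g = z≤n
  ∑-mono-≤ {suc n} f≤g = +-mono-≤ (f≤g zero) (∑-mono-≤ (f≤g ∘ suc))

  ∑-zero : ∀ n → ∑ {n} (λ _ → 0) ≡ 0
  ∑-zero zero    = refl
  ∑-zero (suc n) = ∑-zero n

  countB≡∑ : ∀ {n} (P : Fin n → Bool) → countB P ≡ ∑ (indicator ∘ P)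
  countB≡∑ P = sum-map-allFin (indicator ∘ P)

  countB-false : ∀ n → countB {n} (λ _ → false) ≡ 0
  countB-false n = trans (countB≡∑ {n} (λ _ → false)) (∑-zero n)

  countB-mono : ∀ {n} {P Q : Fin n → Bool} → (∀ x → P x ≡ true → Q x ≡ true) → countB P ≤ countB Q
  countB-mono {P = P} {Q} P⇒Q =
    subst₂ _≤_ (sym (countB≡∑ P)) (sym (countB≡∑ Q)) (∑-mono-≤ (λ x → indicator-mono (P⇒Q x)))
    where
    indicator-mono : ∀ {a b} → (a ≡ true → b ≡ true) → indicator a ≤ indicator b
    indicator-mono {false}     _   = z≤n
    indicator-mono {true}  {b} a⇒b rewrite a⇒b refl = ≤-refl

  ∣tabulate∣≡∑ : ∀ {n} (P : Fin n → Bool) → ∣ tabulate P ∣ ≡ ∑ (indicator ∘ P)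
  ∣tabulate∣≡∑ {zero}  P = refl
  ∣tabulate∣≡∑ {suc n} P with P zero
  ... | true  = cong suc (∣tabulate∣≡∑ (P ∘ suc))
  ... | false = ∣tabulate∣≡∑ (P ∘ suc)

  ∣p∣≡∑ : ∀ {n} (p : Subset n) → ∣ p ∣ ≡ ∑ (indicator ∘ lookup p)
  ∣p∣≡∑ p = trans (cong ∣_∣ (sym (tabulate∘lookup p))) (∣tabulate∣≡∑ (lookup p))

  countB≡∣tabulate∣ : ∀ {n} (P : Fin n → Bool) → countB P ≡ ∣ tabulate P ∣
  countB≡∣tabulate∣ P = trans (countB≡∑ P) (sym (∣tabulate∣≡∑ P))

  disjoint-tail : ∀ {n x y} {p q : Subset n} → Disjoint (x ∷ p) (y ∷ q) → Disjoint p q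
  disjoint-tail disj i i∈p i∈q = disj (suc i) (there i∈p) (there i∈q)

  ∣p∪q∣≡∣p∣+∣q∣ : ∀ {n} {p q : Subset n} → Disjoint p q → ∣ p ∪ q ∣ ≡ ∣ p ∣ + ∣ q ∣
  ∣p∪q∣≡∣p∣+∣q∣ {p = []}        {[]}          _    = refl
  ∣p∪q∣≡∣p∣+∣q∣ {p = true  ∷ p} {true  ∷ q} disj = ⊥-elim (disj zero here here)
  ∣p∪q∣≡∣p∣+∣q∣ {p = true  ∷ p} {false ∷ q} disj = cong suc (∣p∪q∣≡∣p∣+∣q∣ (disjoint-tail disj))
  ∣p∪q∣≡∣p∣+∣q∣ {p = false ∷ p} {true  ∷ q} disj =
    trans (cong suc (∣p∪q∣≡∣p∣+∣q∣ (disjoint-tail disj))) (sym (+-suc ∣ p ∣ ∣ q ∣))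
  ∣p∪q∣≡∣p∣+∣q∣ {p = false ∷ p} {false ∷ q} disj = ∣p∪q∣≡∣p∣+∣q∣ (disjoint-tail disj)

  ∣p∣≡∣p─q∣+∣p∩q∣ : ∀ {n} (p q : Subset n) → ∣ p ∣ ≡ ∣ p ─ q ∣ + ∣ p ∩ q ∣
  ∣p∣≡∣p─q∣+∣p∩q∣ []          []          = refl
  ∣p∣≡∣p─q∣+∣p∩q∣ (true  ∷ p) (true  ∷ q) =
    trans (cong suc (∣p∣≡∣p─q∣+∣p∩q∣ p q)) (sym (+-suc ∣ p ─ q ∣ ∣ p ∩ q ∣))
  ∣p∣≡∣p─q∣+∣p∩q∣ (true  ∷ p) (false ∷ q) = cong suc (∣p∣≡∣p─q∣+∣p∩q∣ p q)
  ∣p∣≡∣p─q∣+∣p∩q∣ (false ∷ p) (true  ∷ q) = ∣p∣≡∣p─q∣+∣p∩q∣ p q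
  ∣p∣≡∣p─q∣+∣p∩q∣ (false ∷ p) (false ∷ q) = ∣p∣≡∣p─q∣+∣p∩q∣ p q

  x∈p─q⇒x∉q : ∀ {n} {x : Fin n} {p q : Subset n} → x ∈ p ─ q → x ∉ q
  x∈p─q⇒x∉q {p = true ∷ p} {false ∷ q} here        ()
  x∈p─q⇒x∉q {p = _    ∷ p} {_     ∷ q} (there x∈) (there x∈q) = x∈p─q⇒x∉q x∈ x∈q

  0<∣p∣⇒Nonempty : ∀ {n} (p : Subset n) → 0 < ∣ p ∣ → Nonempty p
  0<∣p∣⇒Nonempty (true  ∷ p) _   = zero , here
  0<∣p∣⇒Nonempty (false ∷ p) pos with 0<∣p∣⇒Nonempty p pos
  ... | x , x∈p = suc x , there x∈p

  ∃-⊆-of-size : ∀ {n} (p : Subset n) k → k ≤ ∣ p ∣ → ∃ λ q → q ⊆ p × ∣ q ∣ ≡ k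
  ∃-⊆-of-size {n} p       zero    _ = ∅ , ⊥⊆ , ∣⊥∣≡0 n
  ∃-⊆-of-size (true  ∷ p) (suc k) (s≤s k≤∣p∣) with ∃-⊆-of-size p k k≤∣p∣
  ... | q , q⊆p , ∣q∣≡k = true ∷ q , s⊆s q⊆p , cong suc ∣q∣≡k
  ∃-⊆-of-size (false ∷ p) (suc k) k<∣p∣ with ∃-⊆-of-size p (suc k) k<∣p∣
  ... | q , q⊆p , ∣q∣≡k = false ∷ q , s⊆s q⊆p , ∣q∣≡k

  -- The count behind balancedPair: s = |S ∩ B|, r = |S ∖ B|, b = |B| and c = |B ∖ R|,
  -- where the top-up R has a + 1 ∸ r elements.
  remainder-large : ∀ a s r b c → 3 * a < s + r → s ≤ b → 2 * a < b → 2 ≤ b →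
                    b ≤ c + (suc a ∸ r) → suc a ≤ c
  remainder-large zero s r b c _ _ _ 2≤b b≤c+x = +-cancelʳ-≤ 1 1 c (begin
    2               ≤⟨ 2≤b ⟩
    b               ≤⟨ b≤c+x ⟩
    c + (1 ∸ r)     ≤⟨ +-monoʳ-≤ c (m∸n≤m 1 r) ⟩
    c + 1           ∎)
    where open ≤-Reasoning
  remainder-large a@(suc a-1) s r b c 3a<s+r s≤b 2a<b _ b≤c+x with suc a ≤? r
  ... | yes a<r = begin
    suc a             ≤⟨ s≤s (m≤m+n a (a + 0)) ⟩
    suc (2 * a)       ≤⟨ 2a<b ⟩
    b                 ≤⟨ b≤c+x ⟩
    c + (suc a ∸ r)   ≡⟨ cong (c +_) (m≤n⇒m∸n≡0 a<r) ⟩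
    c + 0             ≡⟨ +-identityʳ c ⟩
    c                 ∎
    where open ≤-Reasoning
  ... | no a≮r = begin
    suc a             ≤⟨ s≤s (m≤n+m a a-1) ⟩
    a + a             ≡⟨ cong (a +_) (+-identityʳ a) ⟨
    2 * a             ≤⟨ +-cancelʳ-≤ (suc a) (2 * a) c 2a+a<c+a ⟩
    c                 ∎
    where
    open ≤-Reasoning
    2a+a<c+a : 2 * a + suc a ≤ c + suc a
    2a+a<c+a = begin
      2 * a + suc a           ≡⟨ +-suc (2 * a) a ⟩
      suc (2 * a + a)         ≡⟨ cong suc (+-comm (2 * a) a) ⟩
      suc (3 * a)             ≤⟨ 3a<s+r ⟩
      s + r                   ≤⟨ +-monoˡ-≤ r (≤-trans s≤b b≤c+x) ⟩
      c + (suc a ∸ r) + r     ≡⟨ +-assoc c _ r ⟩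
      c + (suc a ∸ r + r)     ≡⟨ cong (c +_) (m∸n+n≡m (<⇒≤ (≰⇒> a≮r))) ⟩
      c + suc a               ∎

  record BalancedPair {n} (S B : Subset n) (k : ℕ) : Set where
    field
      left right   : Subset n
      left⊆S       : left ⊆ S
      right⊆B      : right ⊆ B
      disjoint     : Disjoint left right
      k≤∣left∣     : k ≤ ∣ left ∣
      k≤∣right∣    : k ≤ ∣ right ∣
      ∣B∣≤2∣right∣ : ∣ B ∣ ≤ 2 * ∣ right ∣

  module TopUp {n} (S B R : Subset n) (R⊆S∩B : R ⊆ S ∩ B) where

    left right : Subset n
    left  = (S ─ B) ∪ R
    right = B ─ R

    left⊆S : left ⊆ S
    left⊆S y∈left with x∈p∪q⁻ (S ─ B) R y∈left
    ... | inj₁ y∈S─B = p─q⊆p S B y∈S─B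
    ... | inj₂ y∈R   = p∩q⊆p S B (R⊆S∩B y∈R)

    disjoint : Disjoint left right
    disjoint y y∈left y∈right with x∈p∪q⁻ (S ─ B) R y∈left
    ... | inj₁ y∈S─B = x∈p─q⇒x∉q y∈S─B (p─q⊆p B R y∈right)
    ... | inj₂ y∈R   = x∈p─q⇒x∉q y∈right y∈R

    ∣left∣≡∣S─B∣+∣R∣ : ∣ left ∣ ≡ ∣ S ─ B ∣ + ∣ R ∣
    ∣left∣≡∣S─B∣+∣R∣ = ∣p∪q∣≡∣p∣+∣q∣ {p = S ─ B} {R} λ y y∈S─B y∈R → x∈p─q⇒x∉q {p = S} y∈S─B (p∩q⊆q S B (R⊆S∩B y∈R))

    ∣B∣≤∣right∣+∣R∣ : ∣ B ∣ ≤ ∣ right ∣ + ∣ R ∣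
    ∣B∣≤∣right∣+∣R∣ = begin
      ∣ B ∣                  ≡⟨ ∣p∣≡∣p─q∣+∣p∩q∣ B R ⟩
      ∣ right ∣ + ∣ B ∩ R ∣  ≤⟨ +-monoʳ-≤ ∣ right ∣ (∣p∩q∣≤∣q∣ B R) ⟩
      ∣ right ∣ + ∣ R ∣      ∎
      where open ≤-Reasoning

  balancedPair : ∀ {n} (S B : Subset n) a → 3 * a < ∣ S ∣ → 2 * a < ∣ B ∣ → 2 ≤ ∣ B ∣ →
                 BalancedPair S B (suc a)
  balancedPair S B a 3a<∣S∣ 2a<∣B∣ 2≤∣B∣ = fromTopUp (∃-⊆-of-size (S ∩ B) x x≤s)
    where
    r = ∣ S ─ B ∣
    s = ∣ S ∩ B ∣
    x = suc a ∸ r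
    3a<s+r : 3 * a < s + r
    3a<s+r = subst (3 * a <_) (trans (∣p∣≡∣p─q∣+∣p∩q∣ S B) (+-comm r s)) 3a<∣S∣
    x≤s : x ≤ s
    x≤s = m≤n+o⇒m∸n≤o (suc a) r (≤-trans (s≤s (m≤m+n a _)) (subst (3 * a <_) (+-comm s r) 3a<s+r))
    fromTopUp : (∃ λ R → R ⊆ S ∩ B × ∣ R ∣ ≡ x) → BalancedPair S B (suc a)
    fromTopUp (R , R⊆S∩B , ∣R∣≡x) = record
      { left         = left
      ; right        = right
      ; left⊆S       = left⊆S
      ; right⊆B      = p─q⊆p B R
      ; disjoint     = disjoint
      ; k≤∣left∣     = begin
          suc a       ≤⟨ m≤n+m∸n (suc a) r ⟩
          r + x       ≡⟨ cong (r +_) ∣R∣≡x ⟨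
          r + ∣ R ∣   ≡⟨ ∣left∣≡∣S─B∣+∣R∣ ⟨
          ∣ left ∣    ∎
      ; k≤∣right∣    = k≤∣right∣
      ; ∣B∣≤2∣right∣ = begin
          ∣ B ∣                  ≤⟨ ∣B∣≤∣right∣+∣R∣ ⟩
          ∣ right ∣ + ∣ R ∣      ≤⟨ +-monoʳ-≤ ∣ right ∣ ∣R∣≤∣right∣ ⟩
          ∣ right ∣ + ∣ right ∣  ≡⟨ cong (∣ right ∣ +_) (+-identityʳ ∣ right ∣) ⟨
          2 * ∣ right ∣          ∎
      }
      where
      open ≤-Reasoning
      open TopUp S B R R⊆S∩B
      k≤∣right∣ : suc a ≤ ∣ right ∣
      k≤∣right∣ = remainder-large a s r ∣ B ∣ ∣ right ∣ 3a<s+r (∣p∩q∣≤∣q∣ S B) 2a<∣B∣ 2≤∣B∣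
        (subst (λ m → ∣ B ∣ ≤ ∣ right ∣ + m) ∣R∣≡x ∣B∣≤∣right∣+∣R∣)
      ∣R∣≤∣right∣ : ∣ R ∣ ≤ ∣ right ∣
      ∣R∣≤∣right∣ = ≤-trans (≤-reflexive ∣R∣≡x) (≤-trans (m∸n≤m (suc a) r) k≤∣right∣)

open Combinatorics

open import Data.Nat using (ℕ; NonZero)
import Data.Nat as ℕ
import Data.Nat.Properties as ℕ
import Data.Nat.Coprimality as Coprime
open import Data.Integer using (+_)
import Data.Integer as ℤ
import Data.Integer.Properties as ℤ
open import Data.Rational
  using (ℚ; mkℚ; _/_; _≤_; _<_; _+_; _*_; ½; 0ℚ; 1ℚ; *≤*; *<*; Positive; NonNegative; nonNegative)
open import Data.Rational.Properties
open import Data.Rational.Solver using (module +-*-Solver)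

-- toℚ k = + k / 1 is normalised through gcd, which is stuck for variable k (and slow to
-- evaluate on literals); every fact about toℚ is proved through this closed form instead.
toℚ≡mkℚ : ∀ k → toℚ k ≡ mkℚ (+ k) 0 (Coprime.sym (Coprime.1-coprimeTo k))
toℚ≡mkℚ k = normalize-coprime _

toℚ-+ : ∀ a b → toℚ (a ℕ.+ b) ≡ toℚ a + toℚ b
toℚ-+ a b rewrite toℚ≡mkℚ a | toℚ≡mkℚ b =
  /-cong (sym (cong₂ ℤ._+_ (ℤ.*-identityʳ (+ a)) (ℤ.*-identityʳ (+ b)))) refl

toℚ-* : ∀ a b → toℚ (a ℕ.* b) ≡ toℚ a * toℚ b
toℚ-* a b rewrite toℚ≡mkℚ a | toℚ≡mkℚ b = /-cong (ℤ.pos-* a b) refl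

toℚ-mono-≤ : ∀ {a b} → a ℕ.≤ b → toℚ a ≤ toℚ b
toℚ-mono-≤ {a} {b} a≤b rewrite toℚ≡mkℚ a | toℚ≡mkℚ b =
  *≤* (subst₂ ℤ._≤_ (sym (ℤ.*-identityʳ (+ a))) (sym (ℤ.*-identityʳ (+ b))) (ℤ.+≤+ a≤b))

toℚ-cancel-≤ : ∀ {a b} → toℚ a ≤ toℚ b → a ℕ.≤ b
toℚ-cancel-≤ {a} {b} le rewrite toℚ≡mkℚ a | toℚ≡mkℚ b with le
... | *≤* le′ with subst₂ ℤ._≤_ (ℤ.*-identityʳ (+ a)) (ℤ.*-identityʳ (+ b)) le′
...   | ℤ.+≤+ a≤b = a≤b

toℚ-cancel-< : ∀ {a b} → toℚ a < toℚ b → a ℕ.< b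
toℚ-cancel-< {a} {b} lt rewrite toℚ≡mkℚ a | toℚ≡mkℚ b with lt
... | *<* lt′ with subst₂ ℤ._<_ (ℤ.*-identityʳ (+ a)) (ℤ.*-identityʳ (+ b)) lt′
...   | ℤ.+<+ a<b = a<b

0≤toℚ : ∀ k → 0ℚ ≤ toℚ k
0≤toℚ k = toℚ-mono-≤ {0} {k} ℕ.z≤n

toℚ-nonNeg : ∀ k → NonNegative (toℚ k)
toℚ-nonNeg k = nonNegative (0≤toℚ k)

toℚ-pos : ∀ k .{{_ : NonZero k}} → Positive (toℚ k)
toℚ-pos (ℕ.suc k) rewrite toℚ≡mkℚ (ℕ.suc k) = _

/-*-cancel : ∀ e n .{{_ : NonZero n}} → (+ e / n) * toℚ n ≡ toℚ e
/-*-cancel e n@(ℕ.suc k) = begin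
  (+ e / n) * toℚ n            ≡⟨ cong (_* toℚ n) e/n≡e*1/n ⟩
  toℚ e * 1/n * toℚ n          ≡⟨ *-assoc (toℚ e) 1/n (toℚ n) ⟩
  toℚ e * (1/n * toℚ n)        ≡⟨ cong (toℚ e *_) 1/n*n≡1 ⟩
  toℚ e * 1ℚ                   ≡⟨ *-identityʳ (toℚ e) ⟩
  toℚ e                        ∎
  where
  open ≡-Reasoning
  1/n : ℚ
  1/n = + 1 / n
  1/n≡mkℚ : 1/n ≡ mkℚ (+ 1) k (Coprime.1-coprimeTo n)
  1/n≡mkℚ = normalize-coprime _
  e/n≡e*1/n : + e / n ≡ toℚ e * 1/n
  e/n≡e*1/n rewrite 1/n≡mkℚ | toℚ≡mkℚ e = /-cong (sym (ℤ.*-identityʳ (+ e))) (sym (ℕ.+-identityʳ n))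
  1/n*n≡1 : 1/n * toℚ n ≡ 1ℚ
  1/n*n≡1 rewrite 1/n≡mkℚ | toℚ≡mkℚ n = *-inverseˡ (mkℚ (+ n) 0 (Coprime.sym (Coprime.1-coprimeTo n)))

toℚ-*-<-cancel : ∀ k a .{{_ : NonZero k}} {ℓ q} → toℚ a < q → toℚ k * q ≤ toℚ ℓ → k ℕ.* a ℕ.< ℓ
toℚ-*-<-cancel k a {ℓ} {q} a<q kq≤ℓ = toℚ-cancel-< (begin-strict
  toℚ (k ℕ.* a)      ≡⟨ toℚ-* k a ⟩
  toℚ k * toℚ a      <⟨ *-monoʳ-<-pos (toℚ k) {{toℚ-pos k}} a<q ⟩
  toℚ k * q          ≤⟨ kq≤ℓ ⟩
  toℚ ℓ              ∎)
  where open ≤-Reasoning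

toℚ-*-≤-cancel : ∀ k a {ℓ q} → toℚ a ≤ q → toℚ k * q ≤ toℚ ℓ → k ℕ.* a ℕ.≤ ℓ
toℚ-*-≤-cancel k a {ℓ} {q} a≤q kq≤ℓ = toℚ-cancel-≤ (begin
  toℚ (k ℕ.* a)      ≡⟨ toℚ-* k a ⟩
  toℚ k * toℚ a      ≤⟨ *-monoˡ-≤-nonNeg (toℚ k) {{toℚ-nonNeg k}} a≤q ⟩
  toℚ k * q          ≤⟨ kq≤ℓ ⟩
  toℚ ℓ              ∎)
  where open ≤-Reasoning

∃-ceiling : ∀ N {q} → 0ℚ < q → q ≤ toℚ N → ∃ λ k → toℚ k < q × q ≤ toℚ (ℕ.suc k)
∃-ceiling ℕ.zero    0<q q≤0 = ⊥-elim (<-irrefl refl (<-≤-trans 0<q q≤0))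
∃-ceiling (ℕ.suc N) {q} 0<q q≤N+1 with q ≤? toℚ N
... | yes q≤N = ∃-ceiling N 0<q q≤N
... | no  q≰N = N , ≰⇒> q≰N , q≤N+1

toℚ∑*-unfold : ∀ {n} (c : Fin (ℕ.suc n) → ℕ) (t : ℚ) →
             toℚ (∑ c) * t ≡ toℚ (c zero) * t + toℚ (∑ (c ∘ suc)) * t
toℚ∑*-unfold c t = trans (cong (_* t) (toℚ-+ (c zero) (∑ (c ∘ suc)))) (*-distribʳ-+ t (toℚ (c zero)) _)

∑-≤-* : ∀ {n} (f c : Fin n → ℕ) (t : ℚ) → (∀ x → toℚ (f x) ≤ toℚ (c x) * t) →
        toℚ (∑ f) ≤ toℚ (∑ c) * t
∑-≤-* {ℕ.zero}  f c t f≤ct = ≤-reflexive (sym (*-zeroˡ t))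
∑-≤-* {ℕ.suc n} f c t f≤ct = begin
  toℚ (∑ f)                                  ≡⟨ toℚ-+ (f zero) (∑ (f ∘ suc)) ⟩
  toℚ (f zero) + toℚ (∑ (f ∘ suc))           ≤⟨ +-mono-≤ (f≤ct zero) (∑-≤-* (f ∘ suc) (c ∘ suc) t (f≤ct ∘ suc)) ⟩
  toℚ (c zero) * t + toℚ (∑ (c ∘ suc)) * t   ≡⟨ toℚ∑*-unfold c t ⟨
  toℚ (∑ c) * t                              ∎
  where open ≤-Reasoning

∑-<-* : ∀ {n} (f c : Fin n → ℕ) (t : ℚ) → (∀ x → toℚ (f x) ≤ toℚ (c x) * t) →
        ∀ x₀ → toℚ (f x₀) < toℚ (c x₀) * t → toℚ (∑ f) < toℚ (∑ c) * t
∑-<-* {ℕ.suc n} f c t f≤ct x₀ fx₀<cx₀t = begin-strict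
  toℚ (∑ f)                                  ≡⟨ toℚ-+ (f zero) (∑ (f ∘ suc)) ⟩
  toℚ (f zero) + toℚ (∑ (f ∘ suc))           <⟨ head+tail< x₀ fx₀<cx₀t ⟩
  toℚ (c zero) * t + toℚ (∑ (c ∘ suc)) * t   ≡⟨ toℚ∑*-unfold c t ⟨
  toℚ (∑ c) * t                              ∎
  where
  open ≤-Reasoning
  head+tail< : ∀ x₀ → toℚ (f x₀) < toℚ (c x₀) * t →
    toℚ (f zero) + toℚ (∑ (f ∘ suc)) < toℚ (c zero) * t + toℚ (∑ (c ∘ suc)) * t
  head+tail< zero    head< = +-mono-<-≤ head< (∑-≤-* (f ∘ suc) (c ∘ suc) t (f≤ct ∘ suc))
  head+tail< (suc y) tail< = +-mono-≤-< (f≤ct zero) (∑-<-* (f ∘ suc) (c ∘ suc) t (f≤ct ∘ suc) y tail<)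

does≡true⇒ : ∀ {P : Set} (d : Dec P) → does d ≡ true → P
does≡true⇒ (yes p) _  = p
does≡true⇒ (no _)  ()

lookup-⊆ : ∀ {n} {p q : Subset n} {x} → p ⊆ q → lookup p x ≡ true → lookup q x ≡ true
lookup-⊆ {p = p} {x = x} p⊆q px = []=⇒lookup (p⊆q (lookup⇒[]= x p px))

≤density⇒*≤eB : ∀ {n} (G : Graph n) X Y {ρ} → ρ ≤ density G X Y →
                ρ * toℚ (∣ X ∣ ℕ.* ∣ Y ∣) ≤ toℚ (eB G X Y)
≤density⇒*≤eB G X Y {ρ} with ∣ X ∣ ℕ.* ∣ Y ∣
... | ℕ.zero  = λ _ → ≤-trans (≤-reflexive (*-zeroʳ ρ)) (0≤toℚ (eB G X Y))
... | ℕ.suc k = λ ρ≤e/k → ≤-trans (*-monoʳ-≤-nonNeg (toℚ (ℕ.suc k)) {{toℚ-nonNeg (ℕ.suc k)}} ρ≤e/k)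
                                 (≤-reflexive (/-*-cancel (eB G X Y) (ℕ.suc k)))

∧-monoˡ-true : ∀ {a b c} → (a ≡ true → b ≡ true) → a ∧ c ≡ true → b ∧ c ≡ true
∧-monoˡ-true {true} a⇒b ac rewrite a⇒b refl = ac

module LowDegree {n} (G : Graph n) (ρ : ℚ) (B : Subset n) where

  threshold : ℚ
  threshold = ½ * ρ * toℚ ∣ B ∣

  isLowDegree? : ∀ v → Dec (toℚ (degIn G v B) < threshold)
  isLowDegree? v = toℚ (degIn G v B) <? threshold

  lowDegree : Subset n
  lowDegree = tabulate (does ∘ isLowDegree?)

  lowDegCount≡∣lowDegree∣ : lowDegCount G ρ B ≡ ∣ lowDegree ∣
  lowDegCount≡∣lowDegree∣ = countB≡∣tabulate∣ (does ∘ isLowDegree?)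

  ∈lowDegree⇒deg<threshold : ∀ {v} → v ∈ lowDegree → toℚ (degIn G v B) < threshold
  ∈lowDegree⇒deg<threshold {v} v∈ =
    does≡true⇒ (isLowDegree? v) (trans (sym (lookup∘tabulate (does ∘ isLowDegree?) v)) ([]=⇒lookup v∈))

  edges<threshold : ∀ {x Y} → x ∈ lowDegree → Y ⊆ B →
                    toℚ (countB (λ y → lookup Y y ∧ adj G x y)) < toℚ (indicator true) * threshold
  edges<threshold {x} {Y} x∈low Y⊆B = begin-strict
    toℚ (countB (λ y → lookup Y y ∧ adj G x y))   ≤⟨ toℚ-mono-≤ (countB-mono λ y → ∧-monoˡ-true {c = adj G x y} (lookup-⊆ Y⊆B)) ⟩
    toℚ (degIn G x B)                              <⟨ ∈lowDegree⇒deg<threshold x∈low ⟩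
    threshold                                      ≡⟨ *-identityˡ threshold ⟨
    toℚ (indicator true) * threshold               ∎
    where open ≤-Reasoning

  edges≤indicator*threshold : ∀ a {x Y} → (a ≡ true → x ∈ lowDegree) → Y ⊆ B →
    toℚ (countB (λ y → a ∧ lookup Y y ∧ adj G x y)) ≤ toℚ (indicator a) * threshold
  edges≤indicator*threshold true  x∈low Y⊆B = <⇒≤ (edges<threshold (x∈low refl) Y⊆B)
  edges≤indicator*threshold false _     _   = begin
    toℚ (countB {n} (λ _ → false))   ≡⟨ cong toℚ (countB-false n) ⟩
    0ℚ                               ≡⟨ *-zeroˡ threshold ⟨
    toℚ (indicator false) * threshold ∎
    where open ≤-Reasoning

  eB<∣X∣*threshold : ∀ {X Y} → X ⊆ lowDegree → Y ⊆ B → Nonempty X →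
                     toℚ (eB G X Y) < toℚ ∣ X ∣ * threshold
  eB<∣X∣*threshold {X} {Y} X⊆low Y⊆B (x₀ , x₀∈X) =
    subst₂ (λ e k → toℚ e < toℚ k * threshold) (sym (sum-map-allFin row)) (sym (∣p∣≡∑ X))
      (∑-<-* row (indicator ∘ lookup X) threshold row≤ x₀ row<)
    where
    row : Fin n → ℕ
    row x = countB (λ y → lookup X x ∧ lookup Y y ∧ adj G x y)
    row≤ : ∀ x → toℚ (row x) ≤ toℚ (indicator (lookup X x)) * threshold
    row≤ x = edges≤indicator*threshold (lookup X x) (X⊆low ∘ lookup⇒[]= x X) Y⊆B
    row< : toℚ (row x₀) < toℚ (indicator (lookup X x₀)) * threshold
    row< = subst (λ b → toℚ (countB (λ y → b ∧ lookup Y y ∧ adj G x₀ y)) < toℚ (indicator b) * threshold)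
                 (sym ([]=⇒lookup x₀∈X)) (edges<threshold (X⊆low x₀∈X) Y⊆B)

  -- A low-degree vertex v has 0 ≤ deg v < (ρ/2)|B|, which forces ρ > 0.
  threshold≤ρ* : Nonempty lowDegree → ∀ {c} → ∣ B ∣ ℕ.≤ 2 ℕ.* c → threshold ≤ ρ * toℚ c
  threshold≤ρ* (v , v∈low) {c} ∣B∣≤2c = begin
    ½ * ρ * toℚ ∣ B ∣          ≤⟨ *-monoˡ-≤-nonNeg (½ * ρ) {{nonNegative (<⇒≤ 0<½ρ)}} (toℚ-mono-≤ ∣B∣≤2c) ⟩
    ½ * ρ * toℚ (2 ℕ.* c)      ≡⟨ cong (½ * ρ *_) (toℚ-* 2 c) ⟩
    ½ * ρ * (toℚ 2 * toℚ c)    ≡⟨ solve 3 (λ r q c → con ½ :* r :* (q :* c) := r :* c :* (con ½ :* q)) refl ρ (toℚ 2) (toℚ c) ⟩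
    ρ * toℚ c * (½ * toℚ 2)    ≡⟨ *-identityʳ (ρ * toℚ c) ⟩
    ρ * toℚ c                  ∎
    where
    open ≤-Reasoning
    open +-*-Solver
    0<½ρ : 0ℚ < ½ * ρ
    0<½ρ = *-cancelʳ-<-nonNeg (toℚ ∣ B ∣) {{toℚ-nonNeg ∣ B ∣}} (begin-strict
      0ℚ * toℚ ∣ B ∣      ≡⟨ *-zeroˡ (toℚ ∣ B ∣) ⟩
      0ℚ                  ≤⟨ 0≤toℚ (degIn G v B) ⟩
      toℚ (degIn G v B)   <⟨ ∈lowDegree⇒deg<threshold v∈low ⟩
      threshold           ∎)

  density<ρ : ∀ {X Y} → X ⊆ lowDegree → Y ⊆ B → ∣ B ∣ ℕ.≤ 2 ℕ.* ∣ Y ∣ → Nonempty X →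
              density G X Y < ρ
  density<ρ {X} {Y} X⊆low Y⊆B ∣B∣≤2∣Y∣ (x₀ , x₀∈X) = ≰⇒> λ ρ≤d → <-irrefl refl (begin-strict
    ρ * toℚ (∣ X ∣ ℕ.* ∣ Y ∣)        ≤⟨ ≤density⇒*≤eB G X Y ρ≤d ⟩
    toℚ (eB G X Y)                  <⟨ eB<∣X∣*threshold X⊆low Y⊆B (x₀ , x₀∈X) ⟩
    toℚ ∣ X ∣ * threshold            ≤⟨ *-monoˡ-≤-nonNeg (toℚ ∣ X ∣) {{toℚ-nonNeg ∣ X ∣}}
                                         (threshold≤ρ* (x₀ , X⊆low x₀∈X) {∣ Y ∣} ∣B∣≤2∣Y∣) ⟩
    toℚ ∣ X ∣ * (ρ * toℚ ∣ Y ∣)       ≡⟨ solve 3 (λ x r y → x :* (r :* y) := r :* (x :* y)) refl (toℚ ∣ X ∣) ρ (toℚ ∣ Y ∣) ⟩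
    ρ * (toℚ ∣ X ∣ * toℚ ∣ Y ∣)       ≡⟨ cong (ρ *_) (toℚ-* ∣ X ∣ ∣ Y ∣) ⟨
    ρ * toℚ (∣ X ∣ ℕ.* ∣ Y ∣)        ∎)
    where
    open ≤-Reasoning
    open +-*-Solver

lemma2p4 : (n : ℕ) .{{_ : NonZero n}} (G : Graph n) (ε ρ : ℚ) →
    BiDense G ε ρ → + 1 / n ≤ ε → (B : Subset n) →
    (+ 2 / 1) * ε * toℚ n ≤ toℚ ∣ B ∣ →
    toℚ (lowDegCount G ρ B) < (+ 3 / 1) * ε * toℚ n
lemma2p4 n G ε ρ dense 1/n≤ε B 2εn≤∣B∣ = ≰⇒> manyLow⇒⊥
  where
  open LowDegree G ρ B
  εn = ε * toℚ n
  1≤εn : 1ℚ ≤ εn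
  1≤εn = ≤-trans (≤-reflexive (sym (/-*-cancel 1 n))) (*-monoʳ-≤-nonNeg (toℚ n) {{toℚ-nonNeg n}} 1/n≤ε)
  2εn≤∣B∣′ : toℚ 2 * εn ≤ toℚ ∣ B ∣
  2εn≤∣B∣′ = subst (_≤ toℚ ∣ B ∣) (*-assoc (toℚ 2) ε (toℚ n)) 2εn≤∣B∣
  εn≤∣B∣ : εn ≤ toℚ ∣ B ∣
  εn≤∣B∣ = begin
    εn           ≡⟨ *-identityˡ εn ⟨
    toℚ 1 * εn   ≤⟨ *-monoʳ-≤-nonNeg εn {{nonNegative (≤-trans (nonNegative⁻¹ 1ℚ) 1≤εn)}} (toℚ-mono-≤ {1} {2} (ℕ.s≤s ℕ.z≤n)) ⟩
    toℚ 2 * εn   ≤⟨ 2εn≤∣B∣′ ⟩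
    toℚ ∣ B ∣    ∎
    where open ≤-Reasoning
  manyLow⇒⊥ : (+ 3 / 1) * ε * toℚ n ≤ toℚ (lowDegCount G ρ B) → ⊥
  manyLow⇒⊥ 3εn≤L = ceiling⇒⊥ (∃-ceiling ∣ B ∣ (<-≤-trans (positive⁻¹ 1ℚ) 1≤εn) εn≤∣B∣)
    where
    ceiling⇒⊥ : (∃ λ a → toℚ a < εn × εn ≤ toℚ (ℕ.suc a)) → ⊥
    ceiling⇒⊥ (a , a<εn , εn≤1+a) = <-irrefl refl (<-≤-trans
        (density<ρ left⊆S right⊆B ∣B∣≤2∣right∣ (0<∣p∣⇒Nonempty left (ℕ.≤-trans (ℕ.s≤s ℕ.z≤n) k≤∣left∣)))
        (dense left right disjoint (εn≤ k≤∣left∣) (εn≤ k≤∣right∣)))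
      where
      3a<∣lowDegree∣ : 3 ℕ.* a ℕ.< ∣ lowDegree ∣
      3a<∣lowDegree∣ = toℚ-*-<-cancel 3 a a<εn
        (subst₂ _≤_ (*-assoc (toℚ 3) ε (toℚ n)) (cong toℚ lowDegCount≡∣lowDegree∣) 3εn≤L)
      open BalancedPair (balancedPair lowDegree B a 3a<∣lowDegree∣
        (toℚ-*-<-cancel 2 a a<εn 2εn≤∣B∣′) (toℚ-*-≤-cancel 2 1 1≤εn 2εn≤∣B∣′))
      εn≤ : ∀ {k} → ℕ.suc a ℕ.≤ k → εn ≤ toℚ k
      εn≤ 1+a≤k = ≤-trans εn≤1+a (toℚ-mono-≤ 1+a≤k)
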